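{- Let $0\le t<k\le v$ be integers and let $\mathcal{D}=([v],\mathcal{B})$ be a Steiner system $S(t,k,v)$ with point set $[v]=\{0,1,\dots,v-1\}$ and block set $\mathcal{B}$. Let $\Gamma_{v,k}$ be Welter's game, and let $$\bar{\mathcal{P}}(\mathcal{D})=\mathcal{B}\cup\bigcup_{B\in\mathcal{B}}N^-_{\Gamma_{v,k}}(B).$$ Then the $\mathsf{P}$-position set of the game $\Gamma_{v,k}[\bar{\mathcal{P}}(\mathcal{D})]$ equals $\mathcal{B}$.
   Context: A Steiner system $S(t,k,v)$ with point set $[v]$ is a pair $([v],\mathcal{B})$ with $\mathcal{B}\subseteq\binom{[v]}{k}$ such that every $t$-subset of $[v]$ is contained in exactly one $B\in\mathcal{B}$. Welter's game $\Gamma_{v,k}$ is the digraph with vertex set $\binom{[v]}{k}$ and edge set $\{(P,P^{(p\,q)}) : q<p,\ p\in P,\ q\notin P\}$, where $P^{(p\,q)}=(P\setminus\{p\})\cup\{q\}$. $N^-_\Gamma(P)$ denotes the set of in-neighbors of $P$ in $\Gamma$, and $\Gamma[\mathcal{Q}]$ denotes the induced subgraph on $\mathcal{Q}$. A game graph is a digraph in which every vertex has a finite maximum walk length. The outcome of a position is defined recursively: a position is $\mathsf{N}$ if it has an option (out-neighbor) that is $\mathsf{P}$, and $\mathsf{P}$ otherwise. The $\mathsf{P}$-position set is the set of positions with outcome $\mathsf{P}$. -}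

module Defs where

open import Level using (Level; _⊔_; suc)
open import Data.Nat using (ℕ)
open import Data.Fin using (Fin; _<_)
open import Data.Fin.Subset using (Subset; _∈_; _∉_; _⊆_; ∣_∣; inside; outside)
open import Data.Vec using (_[_]≔_)
open import Data.Product using (Σ; ∃; _×_; proj₁)
open import Data.Sum using (_⊎_)
open import Relation.Binary.PropositionalEquality using (_≡_)

IsKSubset : {v : ℕ} → ℕ → Subset v → Set
IsKSubset k P = ∣ P ∣ ≡ k

record IsSteiner (t k v : ℕ) (Blk : Subset v → Set) : Set where
  field
    blocks-size : ∀ B → Blk B → IsKSubset k B
    unique-block : ∀ (T : Subset v) → IsKSubset t T →
      Σ (Subset v) λ B → Blk B × T ⊆ B ×
        (∀ B′ → Blk B′ → T ⊆ B′ → B′ ≡ B)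

swap : {v : ℕ} → Subset v → Fin v → Fin v → Subset v
swap P p q = (P [ p ]≔ outside) [ q ]≔ inside

WelterMove : {v : ℕ} → Subset v → Subset v → Set
WelterMove {v} P Q =
  Σ (Fin v) λ p → Σ (Fin v) λ q → q < p × p ∈ P × q ∉ P × Q ≡ swap P p q

mutual
  data IsP {a ℓ : Level} {V : Set a} (E : V → V → Set ℓ) (x : V) : Set (a ⊔ ℓ) where
    isP : (∀ y → E x y → IsN E y) → IsP E x

  data IsN {a ℓ : Level} {V : Set a} (E : V → V → Set ℓ) (x : V) : Set (a ⊔ ℓ) where
    isN : ∀ y → E x y → IsP E y → IsN E x

InPbar : {v : ℕ} (k : ℕ) (Blk : Subset v → Set) → Subset v → Set
InPbar {v} k Blk P =
  IsKSubset k P × (Blk P ⊎ (Σ (Subset v) λ B → Blk B × WelterMove P B))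

PbarVertex : (v k : ℕ) (Blk : Subset v → Set) → Set
PbarVertex v k Blk = Σ (Subset v) (InPbar k Blk)

PbarEdge : {v k : ℕ} {Blk : Subset v → Set} →
  PbarVertex v k Blk → PbarVertex v k Blk → Set
PbarEdge x y = WelterMove (proj₁ x) (proj₁ y)

-- In a game graph (no infinite play), a set S of positions
--     that is independent (no move between two members of S) and absorbing
--     (every position outside S has a move into S) is exactly the P-set.
--   * Welter's game is a game graph: a move P ↦ P^(p q), q < p, strictly
--     decreases the sum of the elements of P.
--   * Blocks are independent: if B′ = B^(p q) then B and B′ share the k-1 ≥ t
--     points of B \ {p}; any t of them lie in a unique block, so B = B′,
--     which is absurd since q ∈ B′ \ B.
-- Absorption holds by the very definition of P̄(D), and the theorem follows.
module Submission where

open import Defs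
open import Data.Nat using (ℕ; _<_; _≤_)
open import Data.Fin.Subset using (Subset)
open import Data.Product using (proj₁)
open import Function.Bundles using (_⇔_)

open import Level using (Level)
open import Data.Nat using (zero; suc; _+_; z≤n; s≤s)
open import Data.Nat.Properties
  using (≤-refl; ≤-trans; n≤1+n; ≤-pred; +-mono-≤; +-mono-≤-<; +-mono-<-≤)
open import Data.Nat.Induction using (<-wellFounded)
open import Data.Fin as F using (Fin)
open import Data.Fin.Subset using (inside; outside; _∈_; _⊆_; ∣_∣)
open import Data.Fin.Subset.Properties using (p⊆q⇒∣p∣≤∣q∣)
open import Data.Vec using (_∷_; []; _[_]≔_; here; there)
open import Data.Vec.Properties using ([]≔-updates)
open import Data.Product using (Σ; ∃; _,_; proj₂; _×_)
open import Data.Sum using (inj₁; inj₂; _⊎_)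
open import Data.Bool using (true; false)
open import Data.Empty using (⊥-elim)
open import Relation.Nullary using (¬_)
open import Relation.Binary.PropositionalEquality using (_≡_; refl; sym; trans; subst; cong)
open import Function.Base using (flip; _∘_)
open import Function.Bundles using (mk⇔)
open import Induction.WellFounded using (WellFounded; Acc; acc; module Subrelation)
import Relation.Binary.Construct.On as On

private
  variable
    a ℓ s : Level
    n : ℕ

GameGraph : {V : Set a} → (V → V → Set ℓ) → Set _
GameGraph E = WellFounded (flip E)

module _ {V : Set a} (E : V → V → Set ℓ) where

  -- No position is both P and N (this needs no finiteness of plays: the
  -- two derivations are consumed alternately).
  P⇒¬N : ∀ {x} → IsP E x → ¬ IsN E x
  P⇒¬N (isP optionsN) (isN y x→y yP) = P⇒¬N yP (optionsN y x→y)

  module Kernel (S : V → Set s)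
    (independent : ∀ {x y} → S x → S y → ¬ E x y)
    (absorbing : ∀ x → S x ⊎ ∃ λ y → E x y × S y)
    (finite-plays : GameGraph E) where

    -- Every member of S is P: each option leaves S and so has a move back
    -- into S, which by induction is P.
    S⇒P : ∀ {x} → Acc (flip E) x → S x → IsP E x
    option-of-S⇒N : ∀ {x y} → Acc (flip E) y → S x → E x y → IsN E y

    S⇒P (acc rs) sx = isP λ y x→y → option-of-S⇒N (rs x→y) sx x→y

    option-of-S⇒N {y = y} (acc rs) sx x→y with absorbing y
    ... | inj₁ sy = ⊥-elim (independent sx sy x→y)
    ... | inj₂ (z , y→z , sz) = isN z y→z (S⇒P (rs y→z) sz)

    -- A P-position outside S would have an option in S, which is P, not N.
    P⇒S : ∀ x → IsP E x → S x
    P⇒S x xP with absorbing x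
    ... | inj₁ sx = sx
    P⇒S x (isP optionsN) | inj₂ (y , x→y , sy) =
      ⊥-elim (P⇒¬N (S⇒P (finite-plays y) sy) (optionsN y x→y))

    P⇔S : ∀ x → IsP E x ⇔ S x
    P⇔S x = mk⇔ (P⇒S x) (S⇒P (finite-plays x))

delete-card : (P : Subset n) (p : Fin n) → p ∈ P → suc ∣ P [ p ]≔ outside ∣ ≡ ∣ P ∣
delete-card (true  ∷ P) F.zero    here      = refl
delete-card (false ∷ P) (F.suc p) (there h) = delete-card P p h
delete-card (true  ∷ P) (F.suc p) (there h) = cong suc (delete-card P p h)

insert-card : (P : Subset n) (q : Fin n) → ∣ P [ q ]≔ inside ∣ ≤ suc ∣ P ∣
insert-card (true  ∷ P) F.zero    = n≤1+n _
insert-card (false ∷ P) F.zero    = ≤-refl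
insert-card (true  ∷ P) (F.suc q) = s≤s (insert-card P q)
insert-card (false ∷ P) (F.suc q) = insert-card P q

delete-⊆ : (P : Subset n) (p : Fin n) → P [ p ]≔ outside ⊆ P
delete-⊆ (b ∷ P) F.zero    (there h) = there h
delete-⊆ (b ∷ P) (F.suc p) here      = here
delete-⊆ (b ∷ P) (F.suc p) (there h) = there (delete-⊆ P p h)

insert-⊇ : (P : Subset n) (q : Fin n) → P ⊆ P [ q ]≔ inside
insert-⊇ (b ∷ P) F.zero    here      = here
insert-⊇ (b ∷ P) F.zero    (there h) = there h
insert-⊇ (b ∷ P) (F.suc q) here      = here
insert-⊇ (b ∷ P) (F.suc q) (there h) = there (insert-⊇ P q h)

t-subset : (A : Subset n) (t : ℕ) → t ≤ ∣ A ∣ → Σ (Subset n) λ T → T ⊆ A × ∣ T ∣ ≡ t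
t-subset []          zero    _       = [] , (λ ()) , refl
t-subset (b ∷ A)     zero    _       with t-subset A zero z≤n
... | T , T⊆A , ∣T∣ = outside ∷ T , (λ { (there h) → there (T⊆A h) }) , ∣T∣
t-subset (true ∷ A)  (suc t) (s≤s h) with t-subset A t h
... | T , T⊆A , ∣T∣ =
  inside ∷ T , (λ { here → here ; (there h) → there (T⊆A h) }) , cong suc ∣T∣
t-subset (false ∷ A) (suc t) h       with t-subset A (suc t) h
... | T , T⊆A , ∣T∣ = outside ∷ T , (λ { (there h) → there (T⊆A h) }) , ∣T∣

-- The sum of the elements of a subset of Fin n.
elementSum : Subset n → ℕ
elementSum []      = 0
elementSum (_ ∷ P) = elementSum P + ∣ P ∣

elementSum-delete : (P : Subset n) (p : Fin n) → elementSum (P [ p ]≔ outside) ≤ elementSum P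
elementSum-delete (b ∷ P) F.zero    = ≤-refl
elementSum-delete (b ∷ P) (F.suc p) =
  +-mono-≤ (elementSum-delete P p) (p⊆q⇒∣p∣≤∣q∣ (delete-⊆ P p))

elementSum-swap : (P : Subset n) (p q : Fin n) → q F.< p → p ∈ P →
  elementSum (swap P p q) < elementSum P
elementSum-swap (b ∷ P) (F.suc p) F.zero    _        (there p∈P) =
  +-mono-≤-< (elementSum-delete P p) (subst (suc ∣ P [ p ]≔ outside ∣ ≤_) (delete-card P p p∈P) ≤-refl)
elementSum-swap (b ∷ P) (F.suc p) (F.suc q) (s≤s q<p) (there p∈P) =
  +-mono-<-≤ (elementSum-swap P p q q<p p∈P) swap-card
  where
  swap-card : ∣ swap P p q ∣ ≤ ∣ P ∣
  swap-card = ≤-trans (insert-card (P [ p ]≔ outside) q)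
                      (subst (_≤ ∣ P ∣) (sym (delete-card P p p∈P)) ≤-refl)

welter-decreasing : ∀ {P Q : Subset n} → WelterMove P Q → elementSum Q < elementSum P
welter-decreasing {P = P} (p , q , q<p , p∈P , _ , refl) = elementSum-swap P p q q<p p∈P

welter-gameGraph : GameGraph (WelterMove {n})
welter-gameGraph =
  Subrelation.wellFounded welter-decreasing (On.wellFounded elementSum <-wellFounded)

module _ {t k v : ℕ} {Blk : Subset v → Set} (St : IsSteiner t k v Blk) where
  open IsSteiner St

  blocks-sharing-t-points : ∀ {B B′ C} → Blk B → Blk B′ → t ≤ ∣ C ∣ →
    C ⊆ B → C ⊆ B′ → B ≡ B′
  blocks-sharing-t-points {B} {B′} {C} bB bB′ t≤∣C∣ C⊆B C⊆B′
    with t-subset C t t≤∣C∣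
  ... | T , T⊆C , ∣T∣ = trans (unique B bB (C⊆B ∘ T⊆C)) (sym (unique B′ bB′ (C⊆B′ ∘ T⊆C)))
    where
    unique : ∀ B″ → Blk B″ → T ⊆ B″ → B″ ≡ proj₁ (unique-block T ∣T∣)
    unique = proj₂ (proj₂ (proj₂ (unique-block T ∣T∣)))

  -- If t < k there is no Welter move between two blocks: B and B^(p q) share
  -- the k-1 ≥ t points of B \ {p}, so they would be equal although q ∈ B^(p q)
  -- and q ∉ B.
  blocks-independent : t < k → ∀ {B B′} → Blk B → Blk B′ → ¬ WelterMove B B′
  blocks-independent t<k {B} bB bB′ (p , q , _ , p∈B , q∉B , refl) =
    q∉B (subst (q ∈_) (sym B≡B′) ([]≔-updates common q))
    where
    common : Subset v
    common = B [ p ]≔ outside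

    t≤∣common∣ : t ≤ ∣ common ∣
    t≤∣common∣ = ≤-pred (subst (t <_) (sym (trans (delete-card B p p∈B) (blocks-size B bB))) t<k)

    B≡B′ : B ≡ swap B p q
    B≡B′ = blocks-sharing-t-points bB bB′ t≤∣common∣ (delete-⊆ B p) (insert-⊇ common q)

corollary3p2 : (t k v : ℕ) → t < k → k ≤ v →
    (Blk : Subset v → Set) → IsSteiner t k v Blk →
    (x : PbarVertex v k Blk) →
    IsP (PbarEdge {v} {k} {Blk}) x ⇔ Blk (proj₁ x)
corollary3p2 t k v t<k _ Blk St =
  Kernel.P⇔S E isBlock (λ {x} {y} → independent {x} {y}) absorbing
    (On.wellFounded position welter-gameGraph)
  where
  E : PbarVertex v k Blk → PbarVertex v k Blk → Set
  E = PbarEdge {v} {k} {Blk}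

  position : PbarVertex v k Blk → Subset v
  position = proj₁

  isBlock : PbarVertex v k Blk → Set
  isBlock x = Blk (position x)

  asVertex : ∀ {B} → Blk B → PbarVertex v k Blk
  asVertex {B} bB = B , IsSteiner.blocks-size St B bB , inj₁ bB

  independent : ∀ {x y} → isBlock x → isBlock y → ¬ E x y
  independent = blocks-independent St t<k

  absorbing : ∀ x → isBlock x ⊎ ∃ λ y → E x y × isBlock y
  absorbing (_ , _ , inj₁ bP)              = inj₁ bP
  absorbing (_ , _ , inj₂ (B , bB , P→B)) = inj₂ (asVertex bB , P→B , bB)
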